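{- Let $\pi$ be a non-crossing partition of $\{1,\dots,n\}$ and let $P=\theta(\pi)$. Let $c$ and $c'$ be two classes of $\pi$ with $i=\max(c)<j=\max(c')$. Then the classes $c$ and $c'$ can be merged (i.e. replacing them by $c\cup c'$ yields a non-crossing partition) if and only if $i\preceq_P j$.
   Context: A partition of $\{1,\dots,n\}$ is non-crossing if whenever $1\le i<j<k<l\le n$ with $i,k$ in the same class and $j,l$ in the same class, the two classes coincide. For a non-crossing partition $\pi$, $\theta(\pi)=NS^{\alpha_1}NS^{\alpha_2}\cdots NS^{\alpha_n}$ where $\alpha_i$ is the size of the class containing $i$ if $i$ is maximal in its class and $\alpha_i=0$ otherwise; this is a Dyck path (word in $N=+1$, $S=-1$ with $n$ letters of each kind whose prefixes have at least as many $N$ as $S$). For $P=NS^{\alpha_1}\cdots NS^{\alpha_n}$ and $0\le k\le n$, $e_k(P)=k-\sum_{l\le k}\alpha_l$. For $0\le i\le j\le n$, $i\preceq_P j$ means $e_i(P)\ge e_j(P)$ and $e_i(P)\le e_k(P)$ for all $i<k<j$. -}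

module Defs where

open import Data.Nat as ℕ using (ℕ; zero; suc)
open import Data.Nat.Properties using (_≟_)
open import Data.Fin as Fin using (Fin; toℕ)
open import Data.Fin.Properties using (all?) renaming (_≤?_ to _≤ᶠ?_)
open import Data.Integer as ℤ using (ℤ; +_)
open import Data.List using (List; length; filter; allFin; take)
open import Data.Nat.ListAction using (sum)
open import Data.Vec.Functional using (toList)
open import Data.Bool using (if_then_else_)
open import Relation.Nullary using (does)
open import Relation.Nullary.Decidable using (_→-dec_)
open import Relation.Binary.PropositionalEquality using (_≡_)

-- A set partition of {1,…,n} (element number m is the index (m-1) : Fin n),
-- encoded by a block labelling: a and b lie in the same class iff f a ≡ f b.
Partition : ℕ → Set
Partition n = Fin n → ℕ

NonCrossing : ∀ {n} → Partition n → Set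
NonCrossing f = ∀ i j k l → i Fin.< j → j Fin.< k → k Fin.< l →
                f i ≡ f k → f j ≡ f l → f i ≡ f j

IsMax : ∀ {n} → Partition n → Fin n → Set
IsMax f a = ∀ k → f k ≡ f a → k Fin.≤ a

classSize : ∀ {n} → Partition n → Fin n → ℕ
classSize {n} f a = length (filter (λ k → f k ≟ f a) (allFin n))

α : ∀ {n} → Partition n → Fin n → ℕ
α f a = if does (all? (λ k → (f k ≟ f a) →-dec (k ≤ᶠ? a)))
          then classSize f a else 0

-- The Dyck path P = N S^{α₁} N S^{α₂} ⋯ N S^{αₙ} is encoded by its
-- exponent sequence (α₁,…,αₙ) (which determines the word uniquely).
DyckExps : ℕ → Set
DyckExps n = Fin n → ℕ

θ : ∀ {n} → Partition n → DyckExps n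
θ f = α f

-- e_k(P) = k − Σ_{l ≤ k} α_l   (for 0 ≤ k ≤ n; l ranges over 1..k)
e : ∀ {n} → DyckExps n → ℕ → ℤ
e P k = + k ℤ.- + sum (take k (toList P))

_⪯[_]_ : ∀ {n} → ℕ → DyckExps n → ℕ → Set
i ⪯[ P ] j = (e P j ℤ.≤ e P i) × (∀ k → i ℕ.< k → k ℕ.< j → e P i ℤ.≤ e P k)
  where open import Data.Product using (_×_)

merge : ∀ {n} → Partition n → Fin n → Fin n → Partition n
merge f i j k = if does (f k ≟ f j) then f i else f k

module Submission where

-- Cutting the positions after m, each class closed before the cut contributes its size through
-- the exponent at its maximum, so e_m(θ π) counts the elements before the cut whose class
-- continues past it.  Merging the classes of i and j creates a crossing exactly when some other
-- class straddles: it has an element u strictly between i and j and one outside [i, j].  If the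
-- class of u continues past j, the count after j exceeds the count after i; otherwise it has an
-- element left of i and ends at some p < j, and the count after p drops below the count after i.
-- Conversely, an element counted after i but not at a later cut k ≤ j, or counted after j but
-- not after i, lies in a straddling class.

open import Defs
open import Data.Nat using (suc)
open import Data.Fin using (Fin; toℕ; _<_)
open import Function.Bundles using (_⇔_)

open import Data.Bool using (if_then_else_)
open import Data.Empty using (⊥; ⊥-elim)
open import Data.Fin using (_≤_; fromℕ<)
import Data.Fin as Fin
open import Data.Fin.Induction using (>-wellFounded)
open import Data.Fin.Properties using (all?; any?; ¬∀⟶∃¬; toℕ-injective; suc-injective; toℕ-fromℕ<; toℕ<n)
  renaming (_≟_ to _≟ᶠ_; _≤?_ to _≤ᶠ?_)
import Data.Integer as ℤ
import Data.Integer.Properties as ℤₚ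
open import Data.List using (filter; length; tabulate; take)
open import Data.Nat as ℕ using (ℕ; zero; _+_; _∸_; z≤n; s≤s)
open import Data.Nat.ListAction using (sum)
import Data.Nat.Properties as ℕ
open import Data.Nat.Properties using (_≟_)
open import Data.Product using (_×_; _,_; proj₁; proj₂; ∃-syntax)
open import Data.Sum as Sum using (_⊎_; inj₁; inj₂; [_,_])
open import Data.Vec.Functional using (toList)
open import Function using (_∘_; id; _⟨_⟩_)
open import Function.Bundles using (mk⇔; Equivalence)
open import Function.Properties.Equivalence using () renaming (trans to ⇔-trans; sym to ⇔-sym)
open import Induction.WellFounded using (Acc; acc)
open import Relation.Binary.Definitions using (tri<; tri≈; tri>)
open import Relation.Binary.PropositionalEquality
  using (_≡_; _≢_; refl; sym; trans; cong; subst; subst₂; module ≡-Reasoning)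
open import Relation.Nullary using (Dec; yes; no; does; ¬_; contradiction)
open import Relation.Nullary.Decidable using (_⊎-dec_; _×-dec_; _→-dec_; dec-true; dec-false)
open import Relation.Unary using (Pred; Decidable; _⊆_)
open import Algebra.Properties.CommutativeMonoid.Sum ℕ.+-0-commutativeMonoid
  using (sum-syntax; ∑-distrib-+; sum-cong-≗)

indicator : ∀ {p} {P : Set p} → Dec P → ℕ
indicator (yes _) = 1
indicator (no _)  = 0

count : ∀ {p} {n} {P : Pred (Fin n) p} → Decidable P → ℕ
count {n = n} P? = ∑[ x < n ] indicator (P? x)

module _ {p q} {P : Set p} {Q : Set q} where

  indicator-cong : (p? : Dec P) (q? : Dec Q) → P ⇔ Q → indicator p? ≡ indicator q?
  indicator-cong (yes _) (yes _) _   = refl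
  indicator-cong (no _)  (no _)  _   = refl
  indicator-cong (yes p) (no ¬q) P⇔Q = contradiction (Equivalence.to P⇔Q p) ¬q
  indicator-cong (no ¬p) (yes q) P⇔Q = contradiction (Equivalence.from P⇔Q q) ¬p

  indicator-mono : (p? : Dec P) (q? : Dec Q) → (P → Q) → indicator p? ℕ.≤ indicator q?
  indicator-mono (yes _) (yes _) _   = ℕ.≤-refl
  indicator-mono (no _)  _       _   = z≤n
  indicator-mono (yes p) (no ¬q) P→Q = contradiction (P→Q p) ¬q

  indicator-⊎ : (p? : Dec P) (q? : Dec Q) → ¬ (P × Q) →
                indicator (p? ⊎-dec q?) ≡ indicator p? + indicator q?
  indicator-⊎ (yes p) (yes q) disj = contradiction (p , q) disj
  indicator-⊎ (yes _) (no _)  _    = refl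
  indicator-⊎ (no _)  (yes _) _    = refl
  indicator-⊎ (no _)  (no _)  _    = refl

module _ {p q} {n : ℕ} {P : Pred (Fin n) p} {Q : Pred (Fin n) q} where

  count-cong : (P? : Decidable P) (Q? : Decidable Q) → (∀ x → P x ⇔ Q x) → count P? ≡ count Q?
  count-cong P? Q? P⇔Q = sum-cong-≗ (λ x → indicator-cong (P? x) (Q? x) (P⇔Q x))

  count-⊎ : (P? : Decidable P) (Q? : Decidable Q) → (∀ x → ¬ (P x × Q x)) →
            count (λ x → P? x ⊎-dec Q? x) ≡ count P? + count Q?
  count-⊎ P? Q? disj = trans (sum-cong-≗ (λ x → indicator-⊎ (P? x) (Q? x) (disj x)))
                             (∑-distrib-+ (indicator ∘ P?) (indicator ∘ Q?))

count-mono : ∀ {p q} {n} {P : Pred (Fin n) p} {Q : Pred (Fin n) q}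
             (P? : Decidable P) (Q? : Decidable Q) → P ⊆ Q → count P? ℕ.≤ count Q?
count-mono {n = zero}  P? Q? P⊆Q = z≤n
count-mono {n = suc n} P? Q? P⊆Q =
  ℕ.+-mono-≤ (indicator-mono (P? Fin.zero) (Q? Fin.zero) P⊆Q) (count-mono (P? ∘ Fin.suc) (Q? ∘ Fin.suc) P⊆Q)

count-empty : ∀ {p} {n} {P : Pred (Fin n) p} (P? : Decidable P) → (∀ x → ¬ P x) → count P? ≡ 0
count-empty {n = zero}  P? ∅ = refl
count-empty {n = suc n} P? ∅ with P? Fin.zero
... | yes p = contradiction p (∅ _)
... | no _  = count-empty (P? ∘ Fin.suc) (∅ ∘ Fin.suc)

count-≡ : ∀ {n} (k : Fin n) → count (_≟ᶠ k) ≡ 1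
count-≡ {suc n} Fin.zero =
  cong suc (count-empty {n = n} (λ x → Fin.suc x ≟ᶠ Fin.zero) (λ _ ()))
count-≡ {suc n} (Fin.suc k) =
  trans (count-cong (λ x → Fin.suc x ≟ᶠ Fin.suc k) (_≟ᶠ k) (λ _ → mk⇔ suc-injective (cong Fin.suc)))
        (count-≡ k)

count-< : ∀ {p q} {n} {P : Pred (Fin n) p} {Q : Pred (Fin n) q}
          (P? : Decidable P) (Q? : Decidable Q) → P ⊆ Q → ∀ {y} → Q y → ¬ P y → count P? ℕ.< count Q?
count-< P? Q? P⊆Q {y} Qy ¬Py = begin-strict
  count P?                              <⟨ ℕ.m<m+n (count P?) ℕ.z<s ⟩
  count P? + 1                          ≡⟨ cong (count P? +_) (count-≡ y) ⟨
  count P? + count (_≟ᶠ y)              ≡⟨ count-⊎ P? (_≟ᶠ y) (λ { _ (Px , refl) → ¬Py Px }) ⟨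
  count (λ x → P? x ⊎-dec (x ≟ᶠ y))     ≤⟨ count-mono _ Q? [ P⊆Q , (λ { refl → Qy }) ] ⟩
  count Q?                              ∎
  where open ℕ.≤-Reasoning

length-filter-tabulate : ∀ {a p} {A : Set a} {P : Pred A p} (P? : Decidable P) {n} (f : Fin n → A) →
                         length (filter P? (tabulate f)) ≡ count (P? ∘ f)
length-filter-tabulate P? {zero}  f = refl
length-filter-tabulate P? {suc n} f with P? (f Fin.zero)
... | yes _ = cong suc (length-filter-tabulate P? (f ∘ Fin.suc))
... | no _  = length-filter-tabulate P? (f ∘ Fin.suc)

sum-take-suc : ∀ {n} (f : Fin n → ℕ) (k : Fin n) →
               sum (take (suc (toℕ k)) (toList f)) ≡ sum (take (toℕ k) (toList f)) + f k
sum-take-suc f Fin.zero    = ℕ.+-comm (f Fin.zero) 0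
sum-take-suc f (Fin.suc k) = trans (cong (f Fin.zero +_) (sum-take-suc (f ∘ Fin.suc) k))
                                   (sym (ℕ.+-assoc (f Fin.zero) _ _))

Interleaved : ∀ {n} → Fin n → Fin n → Fin n → Fin n → Set
Interleaved s t u v = s < u × u < t × (v < s ⊎ t < v)

module _ {n : ℕ} (π : Partition n) where

  -- Cut m separates the positions < m from those ≥ m.  The element x is open at the cut
  -- if it lies before the cut while its class reaches past it; e_m(θ π) counts them.
  OpenAt : ℕ → Fin n → Set
  OpenAt m x = toℕ x ℕ.< m × ∃[ w ] (π w ≡ π x × m ℕ.≤ toℕ w)

  openAt? : ∀ m → Decidable (OpenAt m)
  openAt? m x = (toℕ x ℕ.<? m) ×-dec any? (λ w → (π w ≟ π x) ×-dec (m ℕ.≤? toℕ w))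

  openCount : ℕ → ℕ
  openCount m = count (openAt? m)

  isMax? : ∀ k → Dec (IsMax π k)
  isMax? k = all? (λ x → (π x ≟ π k) →-dec (x ≤ᶠ? k))

  ¬isMax⇒larger : ∀ {k} → ¬ IsMax π k → ∃[ w ] (π w ≡ π k × k < w)
  ¬isMax⇒larger {k} ¬kmax with ¬∀⟶∃¬ n _ (λ x → (π x ≟ π k) →-dec (x ≤ᶠ? k)) ¬kmax
  ... | w , ¬[eq→w≤k] with π w ≟ π k
  ...   | yes eq = w , eq , ℕ.≰⇒> (λ w≤k → ¬[eq→w≤k] (λ _ → w≤k))
  ...   | no ¬eq = contradiction (λ eq → contradiction eq ¬eq) ¬[eq→w≤k]

  classMax : ∀ x → ∃[ p ] (π p ≡ π x × IsMax π p × x ≤ p)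
  classMax x = go x (>-wellFounded x)
    where
    go : ∀ x → Acc Fin._>_ x → ∃[ p ] (π p ≡ π x × IsMax π p × x ≤ p)
    go x (acc larger) with isMax? x
    ... | yes xmax = x , refl , xmax , ℕ.≤-refl
    ... | no ¬xmax with ¬isMax⇒larger ¬xmax
    ...   | w , πw≡πx , x<w with go w (larger x<w)
    ...     | p , πp≡πw , pmax , w≤p = p , trans πp≡πw πw≡πx , pmax , ℕ.<⇒≤ (ℕ.<-≤-trans x<w w≤p)

  ClosedAt : Fin n → Fin n → Set
  ClosedAt k x = IsMax π k × π x ≡ π k

  closedAt? : ∀ k → Decidable (ClosedAt k)
  closedAt? k x = isMax? k ×-dec (π x ≟ π k)

  α≡count-closedAt : ∀ k → α π k ≡ count (closedAt? k)
  α≡count-closedAt k = by-cases (isMax? k)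
    where
    by-cases : (kmax? : Dec (IsMax π k)) → (if does kmax? then classSize π k else 0) ≡ count (closedAt? k)
    by-cases (yes kmax) = trans (length-filter-tabulate (λ x → π x ≟ π k) id)
                                (count-cong (λ x → π x ≟ π k) (closedAt? k) (λ x → mk⇔ (kmax ,_) proj₂))
    by-cases (no ¬kmax) = sym (count-empty (closedAt? k) (λ _ → ¬kmax ∘ proj₁))

  private
    open-or-cut : ∀ {k x y} → x ≤ k → π y ≡ π x → k ≤ y → OpenAt (toℕ k) x ⊎ x ≡ k
    open-or-cut {k} {x} {y} x≤k πy≡πx k≤y with ℕ.m≤n⇒m<n∨m≡n x≤k
    ... | inj₁ x<k = inj₁ (x<k , y , πy≡πx , k≤y)
    ... | inj₂ x≡k = inj₂ (toℕ-injective x≡k)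

    open-or-closed : ∀ {k x y} → x ≤ k → π y ≡ π x → k ≤ y → OpenAt (suc (toℕ k)) x ⊎ ClosedAt k x
    open-or-closed {k} {x} {y} x≤k πy≡πx k≤y with ℕ.m≤n⇒m<n∨m≡n k≤y
    ... | inj₁ k<y = inj₁ (s≤s x≤k , y , πy≡πx , k<y)
    ... | inj₂ k≡y with isMax? k
    ...   | yes kmax = inj₂ (kmax , trans (sym πy≡πx) (cong π (toℕ-injective (sym k≡y))))
    ...   | no ¬kmax with ¬isMax⇒larger ¬kmax
    ...     | w , πw≡πk , k<w =
                inj₁ (s≤s x≤k , w , trans πw≡πk (trans (cong π (toℕ-injective k≡y)) πy≡πx) , k<w)

  openAt-suc⇔ : ∀ k x → (OpenAt (suc (toℕ k)) x ⊎ ClosedAt k x) ⇔ (OpenAt (toℕ k) x ⊎ x ≡ k)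
  openAt-suc⇔ k x = mk⇔ to from
    where
    to : OpenAt (suc (toℕ k)) x ⊎ ClosedAt k x → OpenAt (toℕ k) x ⊎ x ≡ k
    to (inj₁ (x<k+1 , w , πw≡πx , k<w)) = open-or-cut (ℕ.≤-pred x<k+1) πw≡πx (ℕ.<⇒≤ k<w)
    to (inj₂ (kmax , πx≡πk))             = open-or-cut (kmax x πx≡πk) (sym πx≡πk) ℕ.≤-refl
    from : OpenAt (toℕ k) x ⊎ x ≡ k → OpenAt (suc (toℕ k)) x ⊎ ClosedAt k x
    from (inj₁ (x<k , w , πw≡πx , k≤w)) = open-or-closed (ℕ.<⇒≤ x<k) πw≡πx k≤w
    from (inj₂ refl)                     = open-or-closed ℕ.≤-refl refl ℕ.≤-refl

  openCount-suc : ∀ k → openCount (suc (toℕ k)) + α π k ≡ openCount (toℕ k) + 1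
  openCount-suc k = begin
    openCount (suc (toℕ k)) + α π k
      ≡⟨ cong (openCount (suc (toℕ k)) +_) (α≡count-closedAt k) ⟩
    openCount (suc (toℕ k)) + count (closedAt? k)
      ≡⟨ count-⊎ (openAt? (suc (toℕ k))) (closedAt? k) open∩closed=∅ ⟨
    count (λ x → openAt? (suc (toℕ k)) x ⊎-dec closedAt? k x)
      ≡⟨ count-cong _ _ (openAt-suc⇔ k) ⟩
    count (λ x → openAt? (toℕ k) x ⊎-dec (x ≟ᶠ k))
      ≡⟨ count-⊎ (openAt? (toℕ k)) (_≟ᶠ k) (λ { _ ((x<k , _) , refl) → ℕ.<-irrefl refl x<k }) ⟩
    openCount (toℕ k) + count (_≟ᶠ k)
      ≡⟨ cong (openCount (toℕ k) +_) (count-≡ k) ⟩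
    openCount (toℕ k) + 1 ∎
    where
    open ≡-Reasoning
    open∩closed=∅ : ∀ x → ¬ (OpenAt (suc (toℕ k)) x × ClosedAt k x)
    open∩closed=∅ x ((_ , w , πw≡πx , k<w) , kmax , πx≡πk) = ℕ.<⇒≱ k<w (kmax w (trans πw≡πx πx≡πk))

  prefixSum : ℕ → ℕ
  prefixSum m = sum (take m (toList (θ π)))

  -- every x < m is either open at m or lies in a class closed before m
  cut≡prefixSum+openCount : ∀ m → m ℕ.≤ n → m ≡ prefixSum m + openCount m
  cut≡prefixSum+openCount zero    _   = sym (count-empty (openAt? 0) (λ _ ()))
  cut≡prefixSum+openCount (suc m) m<n =
    subst Balanced (cong suc (toℕ-fromℕ< m<n))
          (balanced-suc (fromℕ< m<n) (subst Balanced (sym (toℕ-fromℕ< m<n))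
                                            (cut≡prefixSum+openCount m (ℕ.<⇒≤ m<n))))
    where
    Balanced : ℕ → Set
    Balanced m = m ≡ prefixSum m + openCount m
    balanced-suc : ∀ k → Balanced (toℕ k) → Balanced (suc (toℕ k))
    balanced-suc k IH = begin
      suc (toℕ k)                           ≡⟨ cong suc IH ⟩
      suc (S + openCount (toℕ k))           ≡⟨ ℕ.+-suc S _ ⟨
      S + suc (openCount (toℕ k))           ≡⟨ cong (S +_) (ℕ.+-comm 1 _) ⟩
      S + (openCount (toℕ k) + 1)           ≡⟨ cong (S +_) (openCount-suc k) ⟨
      S + (openCount (suc (toℕ k)) + α π k) ≡⟨ cong (S +_) (ℕ.+-comm _ (α π k)) ⟩
      S + (α π k + openCount (suc (toℕ k))) ≡⟨ ℕ.+-assoc S _ _ ⟨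
      S + α π k + openCount (suc (toℕ k))   ≡⟨ cong (_+ openCount (suc (toℕ k))) (sum-take-suc (θ π) k) ⟨
      prefixSum (suc (toℕ k)) + openCount (suc (toℕ k)) ∎
      where
      open ≡-Reasoning
      S = prefixSum (toℕ k)

  e≡openCount : ∀ m → m ℕ.≤ n → e (θ π) m ≡ ℤ.+ openCount m
  e≡openCount m m≤n = begin
    e (θ π) m                 ≡⟨ ℤₚ.m-n≡m⊖n m (prefixSum m) ⟩
    m ℤ.⊖ prefixSum m           ≡⟨ ℤₚ.⊖-≥ (subst (prefixSum m ℕ.≤_) (sym balance) (ℕ.m≤m+n _ _)) ⟩
    ℤ.+ (m ∸ prefixSum m)       ≡⟨ cong (λ t → ℤ.+ (t ∸ prefixSum m)) balance ⟩
    ℤ.+ (prefixSum m + openCount m ∸ prefixSum m) ≡⟨ cong ℤ.+_ (ℕ.m+n∸m≡n (prefixSum m) (openCount m)) ⟩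
    ℤ.+ openCount m             ∎
    where
    open ≡-Reasoning
    balance = cut≡prefixSum+openCount m m≤n

  e≤e⇔openCount≤openCount : ∀ {l m} → l ℕ.≤ n → m ℕ.≤ n →
                            (e (θ π) l ℤ.≤ e (θ π) m) ⇔ (openCount l ℕ.≤ openCount m)
  e≤e⇔openCount≤openCount {l} {m} l≤n m≤n = mk⇔
    (λ el≤em → ℤₚ.drop‿+≤+ (subst₂ ℤ._≤_ (e≡openCount l l≤n) (e≡openCount m m≤n) el≤em))
    (λ ol≤om → subst₂ ℤ._≤_ (sym (e≡openCount l l≤n)) (sym (e≡openCount m m≤n)) (ℤ.+≤+ ol≤om))

  StaysAbove : ℕ → ℕ → Set
  StaysAbove a b = ∀ k → a ℕ.< k → k ℕ.< b → openCount a ℕ.≤ openCount k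

  _⪯ᵒ_ : ℕ → ℕ → Set
  a ⪯ᵒ b = openCount b ℕ.≤ openCount a × StaysAbove a b

  ⪯⇔⪯ᵒ : ∀ {a b} → a ℕ.≤ n → b ℕ.≤ n → a ⪯[ θ π ] b ⇔ a ⪯ᵒ b
  ⪯⇔⪯ᵒ {a} {b} a≤n b≤n = mk⇔
    (λ (eb≤ea , ea≤ek) → to (e≤e b≤n a≤n) eb≤ea ,
                         λ k a<k k<b → to (e≤e a≤n (k≤n k<b)) (ea≤ek k a<k k<b))
    (λ (ob≤oa , oa≤ok) → from (e≤e b≤n a≤n) ob≤oa ,
                         λ k a<k k<b → from (e≤e a≤n (k≤n k<b)) (oa≤ok k a<k k<b))
    where
    open Equivalence
    e≤e = e≤e⇔openCount≤openCount
    k≤n : ∀ {k} → k ℕ.< b → k ℕ.≤ n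
    k≤n k<b = ℕ.<⇒≤ (ℕ.<-≤-trans k<b b≤n)

  module _ (nc : NonCrossing π) where

    interleaved⇒≡ : ∀ {s t u v} → Interleaved s t u v → π s ≡ π t → π u ≡ π v → π s ≡ π u
    interleaved⇒≡ {s} {t} {u} {v} (s<u , u<t , inj₁ v<s) πs≡πt πu≡πv =
      trans (sym (nc v s u t v<s s<u u<t (sym πu≡πv) πs≡πt)) (sym πu≡πv)
    interleaved⇒≡ {s} {t} {u} {v} (s<u , u<t , inj₂ t<v) πs≡πt πu≡πv = nc s u t v s<u u<t t<v πs≡πt πu≡πv

    openCount-after-max< : ∀ {c z x} → IsMax π z → c ℕ.≤ toℕ z → toℕ x ℕ.< c → π x ≡ π z →
                           openCount (suc (toℕ z)) ℕ.< openCount c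
    openCount-after-max< {c} {z} {x} zmax c≤z x<c πx≡πz =
      count-< (openAt? (suc (toℕ z))) (openAt? c) open-after⊆open-at
              (x<c , z , sym πx≡πz , c≤z)
            (λ (_ , w , πw≡πx , z<w) → ℕ.<⇒≱ z<w (zmax w (trans πw≡πx πx≡πz)))
      where
      open-after⊆open-at : OpenAt (suc (toℕ z)) ⊆ OpenAt c
      open-after⊆open-at {y} (y≤z , w , πw≡πy , z<w) with toℕ y ℕ.<? c
      ... | yes y<c = y<c , w , πw≡πy , ℕ.<⇒≤ (ℕ.≤-<-trans c≤z z<w)
      ... | no y≮c  = contradiction (zmax w (trans πw≡πy πy≡πz)) (ℕ.<⇒≱ z<w)
        where
        y<z : y < z
        y<z = ℕ.≤∧≢⇒< (ℕ.≤-pred y≤z)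
                (λ y≡z → ℕ.<⇒≱ z<w (zmax w (trans πw≡πy (cong π (toℕ-injective y≡z)))))
        πy≡πz : π y ≡ π z
        πy≡πz = trans (sym (interleaved⇒≡ (ℕ.<-≤-trans x<c (ℕ.≮⇒≥ y≮c) , y<z , inj₂ z<w)
                                          πx≡πz (sym πw≡πy)))
                      πx≡πz

    module _ {i j : Fin n} (imax : IsMax π i) (jmax : IsMax π j) (i<j : i < j) where

      Merged : Fin n → Set
      Merged x = π x ≡ π i ⊎ π x ≡ π j

      Straddle : Set
      Straddle = ∃[ u ] ∃[ v ] (i < u × u < j × π u ≢ π j × π v ≡ π u × (v < i ⊎ j < v))

      private
        πi≢πj : π i ≢ π j
        πi≢πj πi≡πj = ℕ.<⇒≱ i<j (imax j (sym πi≡πj))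

        Merged-resp : ∀ {x y} → π x ≡ π y → Merged x → Merged y
        Merged-resp πx≡πy = Sum.map (trans (sym πx≡πy)) (trans (sym πx≡πy))

        Merged⇒≤j : ∀ {x} → Merged x → x ≤ j
        Merged⇒≤j (inj₁ πx≡πi) = ℕ.≤-trans (imax _ πx≡πi) (ℕ.<⇒≤ i<j)
        Merged⇒≤j (inj₂ πx≡πj) = jmax _ πx≡πj

        above-i⇒≡j : ∀ {x} → Merged x → i < x → π x ≡ π j
        above-i⇒≡j (inj₁ πx≡πi) i<x = contradiction (imax _ πx≡πi) (ℕ.<⇒≱ i<x)
        above-i⇒≡j (inj₂ πx≡πj) _   = πx≡πj

        position : ∀ {x} → ¬ Merged x → x < i ⊎ (i < x × x < j) ⊎ j < x
        position {x} x∉M with ℕ.<-cmp (toℕ x) (toℕ i) | ℕ.<-cmp (toℕ x) (toℕ j)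
        ... | tri< x<i _ _ | _             = inj₁ x<i
        ... | tri≈ _ x≡i _ | _             = contradiction (inj₁ (cong π (toℕ-injective x≡i))) x∉M
        ... | tri> _ _ i<x | tri< x<j _ _  = inj₂ (inj₁ (i<x , x<j))
        ... | tri> _ _ _   | tri≈ _ x≡j _  = contradiction (inj₂ (cong π (toℕ-injective x≡j))) x∉M
        ... | tri> _ _ _   | tri> _ _ j<x  = inj₂ (inj₂ j<x)

        -- {u, v} crosses the chord from x (resp. t) to the maximum, i or j, of its class
        chord-from-below : ∀ {x u v} → Merged x → x < u → u < i → (v < x ⊎ j < v) → π u ≡ π v → Merged u
        chord-from-below {x} (inj₁ πx≡πi) x<u u<i v∉ πu≡πv =
          inj₁ (trans (sym (interleaved⇒≡ (x<u , u<i , Sum.map₂ (ℕ.<-trans i<j) v∉) πx≡πi πu≡πv)) πx≡πi)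
        chord-from-below {x} (inj₂ πx≡πj) x<u u<i v∉ πu≡πv =
          inj₂ (trans (sym (interleaved⇒≡ (x<u , ℕ.<-trans u<i i<j , v∉) πx≡πj πu≡πv)) πx≡πj)

        chord-over : ∀ {t u v} → Merged t → u < t → t < v → v < i → π u ≡ π v → Merged u
        chord-over (inj₁ πt≡πi) u<t t<v v<i πu≡πv =
          Merged-resp (sym (interleaved⇒≡ (u<t , t<v , inj₂ v<i) πu≡πv πt≡πi)) (inj₁ πt≡πi)
        chord-over (inj₂ πt≡πj) u<t t<v v<i πu≡πv =
          Merged-resp (sym (interleaved⇒≡ (u<t , t<v , inj₂ (ℕ.<-trans v<i i<j)) πu≡πv πt≡πj)) (inj₂ πt≡πj)

      separation⇒straddle : ∀ {s t u v} → Interleaved s t u v → Merged s → Merged t → ¬ Merged u → π u ≡ π v →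
                            Straddle
      separation⇒straddle {s} {t} {u} {v} (s<u , u<t , v∉[s,t]) s∈M t∈M u∉M πu≡πv
        with position u∉M | position (u∉M ∘ Merged-resp (sym πu≡πv))
      ... | inj₂ (inj₂ j<u) | _ = contradiction (Merged⇒≤j t∈M) (ℕ.<⇒≱ (ℕ.<-trans j<u u<t))
      ... | inj₂ (inj₁ (i<u , u<j)) | inj₁ v<i        = u , v , i<u , u<j , u∉M ∘ inj₂ , sym πu≡πv , inj₁ v<i
      ... | inj₂ (inj₁ (i<u , u<j)) | inj₂ (inj₂ j<v) = u , v , i<u , u<j , u∉M ∘ inj₂ , sym πu≡πv , inj₂ j<v
      ... | inj₂ (inj₁ (i<u , _)) | inj₂ (inj₁ (i<v , v<j)) = contradiction (both-inside v∉[s,t]) u∉M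
        where
        πt≡πj : π t ≡ π j
        πt≡πj = above-i⇒≡j t∈M (ℕ.<-trans i<u u<t)
        both-inside : v < s ⊎ t < v → Merged u
        both-inside (inj₁ v<s) = Merged-resp (interleaved⇒≡ (s<u , u<t , inj₁ v<s)
                                            (trans (above-i⇒≡j s∈M (ℕ.<-trans i<v v<s)) (sym πt≡πj)) πu≡πv) s∈M
        both-inside (inj₂ t<v) = Merged-resp (sym (interleaved⇒≡ (u<t , t<v , inj₂ v<j) πu≡πv πt≡πj)) t∈M
      ... | inj₁ u<i | inj₂ (inj₁ (i<v , v<j)) = v , u , i<v , v<j , v∉M ∘ inj₂ , πu≡πv , inj₁ u<i
        where
        v∉M : ¬ Merged v
        v∉M = u∉M ∘ Merged-resp (sym πu≡πv)
      ... | inj₁ u<i | inj₂ (inj₂ j<v)         = contradiction (chord-from-below s∈M s<u u<i (inj₂ j<v) πu≡πv) u∉M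
      ... | inj₁ u<i | inj₁ v<i                = contradiction (both-below v∉[s,t]) u∉M
        where
        both-below : v < s ⊎ t < v → Merged u
        both-below (inj₁ v<s) = chord-from-below s∈M s<u u<i (inj₁ v<s) πu≡πv
        both-below (inj₂ t<v) = chord-over t∈M u<t t<v v<i πu≡πv

      private
        merge-Merged : ∀ {x} → Merged x → merge π i j x ≡ π i
        merge-Merged {x} (inj₁ πx≡πi) = trans (cong (if_then π i else π x) (dec-false (π x ≟ π j) πx≢πj)) πx≡πi
          where
          πx≢πj : π x ≢ π j
          πx≢πj = πi≢πj ∘ trans (sym πx≡πi)
        merge-Merged {x} (inj₂ πx≡πj) = cong (if_then π i else π x) (dec-true (π x ≟ π j) πx≡πj)

        merge-¬Merged : ∀ {x} → ¬ Merged x → merge π i j x ≡ π x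
        merge-¬Merged {x} x∉M = cong (if_then π i else π x) (dec-false (π x ≟ π j) (x∉M ∘ inj₂))

        merge-Merged² : ∀ {x y} → Merged x → Merged y → merge π i j x ≡ merge π i j y
        merge-Merged² x∈M y∈M = trans (merge-Merged x∈M) (sym (merge-Merged y∈M))

        merged? : ∀ x → Dec (Merged x)
        merged? x = (π x ≟ π i) ⊎-dec (π x ≟ π j)

        merge-cong : ∀ {x y} → π x ≡ π y → merge π i j x ≡ merge π i j y
        merge-cong = cong (λ c → if does (c ≟ π j) then π i else c)

        merge-≡ : ∀ {x y} → merge π i j x ≡ merge π i j y → π x ≡ π y ⊎ (Merged x × Merged y)
        merge-≡ {x} {y} gx≡gy with merged? x | merged? y
        ... | yes x∈M | yes y∈M = inj₂ (x∈M , y∈M)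
        ... | yes x∈M | no y∉M  =
              contradiction (inj₁ (trans (sym (merge-¬Merged y∉M)) (trans (sym gx≡gy) (merge-Merged x∈M)))) y∉M
        ... | no x∉M  | yes y∈M =
              contradiction (inj₁ (trans (sym (merge-¬Merged x∉M)) (trans gx≡gy (merge-Merged y∈M)))) x∉M
        ... | no x∉M  | no y∉M  = inj₁ (trans (sym (merge-¬Merged x∉M)) (trans gx≡gy (merge-¬Merged y∉M)))

      straddle⇒crossing : Straddle → ¬ NonCrossing (merge π i j)
      straddle⇒crossing (u , v , i<u , u<j , πu≢πj , πv≡πu , v∉[i,j]) ncg = u∉M (crossing v∉[i,j])
        where
        u∉M : ¬ Merged u
        u∉M = [ (λ πu≡πi → ℕ.<⇒≱ i<u (imax u πu≡πi)) , πu≢πj ]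
        gv≡gu : merge π i j v ≡ merge π i j u
        gv≡gu = merge-cong πv≡πu
        gi≡gj : merge π i j i ≡ merge π i j j
        gi≡gj = merge-Merged² (inj₁ refl) (inj₂ refl)
        crossing : v < i ⊎ j < v → Merged u
        crossing (inj₁ v<i) = inj₁ (begin
          π u            ≡⟨ merge-¬Merged u∉M ⟨
          merge π i j u  ≡⟨ gv≡gu ⟨
          merge π i j v  ≡⟨ ncg v i u j v<i i<u u<j gv≡gu gi≡gj ⟩
          merge π i j i  ≡⟨ merge-Merged (inj₁ refl) ⟩
          π i            ∎)
          where open ≡-Reasoning
        crossing (inj₂ j<v) = inj₁ (begin
          π u            ≡⟨ merge-¬Merged u∉M ⟨
          merge π i j u  ≡⟨ ncg i u j v i<u u<j j<v gi≡gj (sym gv≡gu) ⟨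
          merge π i j i  ≡⟨ merge-Merged (inj₁ refl) ⟩
          π i            ∎)
          where open ≡-Reasoning

      ¬straddle⇒merged-chord : ¬ Straddle → ∀ {s t u v} → Interleaved s t u v → Merged s → Merged t →
                               π u ≡ π v → merge π i j s ≡ merge π i j u
      ¬straddle⇒merged-chord ¬straddle {u = u} st∣uv s∈M t∈M πu≡πv with merged? u
      ... | yes u∈M = merge-Merged² s∈M u∈M
      ... | no u∉M  = contradiction (separation⇒straddle st∣uv s∈M t∈M u∉M πu≡πv) ¬straddle

      ¬straddle⇒nonCrossing : ¬ Straddle → NonCrossing (merge π i j)
      ¬straddle⇒nonCrossing ¬straddle w x y z w<x x<y y<z gw≡gy gx≡gz with merge-≡ gw≡gy | merge-≡ gx≡gz
      ... | inj₁ πw≡πy       | inj₁ πx≡πz       = merge-cong (nc w x y z w<x x<y y<z πw≡πy πx≡πz)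
      ... | inj₂ (w∈M , _)   | inj₂ (x∈M , _)   = merge-Merged² w∈M x∈M
      ... | inj₂ (w∈M , y∈M) | inj₁ πx≡πz       =
            ¬straddle⇒merged-chord ¬straddle (w<x , x<y , inj₂ y<z) w∈M y∈M πx≡πz
      ... | inj₁ πw≡πy       | inj₂ (x∈M , z∈M) =
            trans gw≡gy (sym (¬straddle⇒merged-chord ¬straddle (x<y , y<z , inj₁ w<x) x∈M z∈M (sym πw≡πy)))

      merge-nonCrossing⇔¬straddle : NonCrossing (merge π i j) ⇔ (¬ Straddle)
      merge-nonCrossing⇔¬straddle = mk⇔ (λ ncg straddle → straddle⇒crossing straddle ncg) ¬straddle⇒nonCrossing

      ¬straddle⇒⪯ᵒ : ¬ Straddle → suc (toℕ i) ⪯ᵒ suc (toℕ j)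
      ¬straddle⇒⪯ᵒ ¬straddle =
        count-mono (openAt? (suc (toℕ j))) (openAt? (suc (toℕ i))) open-after-j⊆open-after-i ,
        λ k i+1<k k≤j → count-mono (openAt? (suc (toℕ i))) (openAt? k) (open-after-i⊆open-at i+1<k k≤j)
        where
        open-after-j⊆open-after-i : OpenAt (suc (toℕ j)) ⊆ OpenAt (suc (toℕ i))
        open-after-j⊆open-after-i {y} (y≤j , w , πw≡πy , j<w) with toℕ y ℕ.≤? toℕ i
        ... | yes y≤i = s≤s y≤i , w , πw≡πy , ℕ.<-trans i<j j<w
        ... | no y≰i  = contradiction (y , w , ℕ.≰⇒> y≰i , y<j , πy≢πj , πw≡πy , inj₂ j<w) ¬straddle
          where
          πy≢πj : π y ≢ π j
          πy≢πj πy≡πj = ℕ.<⇒≱ j<w (jmax w (trans πw≡πy πy≡πj))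
          y<j : y < j
          y<j = ℕ.≤∧≢⇒< (ℕ.≤-pred y≤j) (πy≢πj ∘ cong π ∘ toℕ-injective)
        open-after-i⊆open-at : ∀ {k} → suc (toℕ i) ℕ.< k → k ℕ.< suc (toℕ j) →
                               OpenAt (suc (toℕ i)) ⊆ OpenAt k
        open-after-i⊆open-at {k} i+1<k k≤j {y} (y≤i , w , πw≡πy , i<w) with classMax w
        ... | p , πp≡πw , pmax , w≤p with k ℕ.≤? toℕ p
        ...   | yes k≤p = ℕ.<-trans y≤i i+1<k , p , trans πp≡πw πw≡πy , k≤p
        ...   | no k≰p  = contradiction (p , y , i<p , p<j , πp≢πj , sym (trans πp≡πw πw≡πy) , inj₁ y<i) ¬straddle
          where
          i<p : i < p
          i<p = ℕ.<-≤-trans i<w w≤p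
          p<j : p < j
          p<j = ℕ.<-≤-trans (ℕ.≰⇒> k≰p) (ℕ.≤-pred k≤j)
          πp≢πj : π p ≢ π j
          πp≢πj πp≡πj = ℕ.<⇒≱ p<j (pmax j (sym πp≡πj))
          y<i : y < i
          y<i = ℕ.≤∧≢⇒< (ℕ.≤-pred y≤i)
                  (λ y≡i → ℕ.<⇒≱ i<p (imax p (trans (trans πp≡πw πw≡πy) (cong π (toℕ-injective y≡i)))))

      module _ (above : StaysAbove (suc (toℕ i)) (suc (toℕ j))) where

        private
          no-class-max-between-reaching-below : ∀ {z x} → IsMax π z → i < z → z < j → π x ≡ π z → x ≤ i → ⊥
          no-class-max-between-reaching-below {z} zmax i<z z<j πx≡πz x≤i =
            ℕ.<⇒≱ (openCount-after-max< zmax i<z (s≤s x≤i) πx≡πz) (above (suc (toℕ z)) (s≤s i<z) (s≤s z<j))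

        openCount-after-i<after-j : ∀ {u v} → i < u → u < j → π u ≢ π j → j < v → π v ≡ π u →
                                    openCount (suc (toℕ i)) ℕ.< openCount (suc (toℕ j))
        openCount-after-i<after-j {u} {v} i<u u<j πu≢πj j<v πv≡πu =
          count-< (openAt? (suc (toℕ i))) (openAt? (suc (toℕ j))) open-after-i⊆open-after-j
                  (ℕ.m<n⇒m<1+n u<j , v , πv≡πu , j<v) (λ (u≤i , _) → ℕ.<⇒≱ i<u (ℕ.≤-pred u≤i))
          where
          open-after-i⊆open-after-j : OpenAt (suc (toℕ i)) ⊆ OpenAt (suc (toℕ j))
          open-after-i⊆open-after-j {y} (y≤i , w , πw≡πy , i<w) with classMax w
          ... | p , πp≡πw , pmax , w≤p with ℕ.<-cmp (toℕ p) (toℕ j)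
          ...   | tri< p<j _ _ = ⊥-elim (no-class-max-between-reaching-below pmax (ℕ.<-≤-trans i<w w≤p) p<j
                                           (sym (trans πp≡πw πw≡πy)) (ℕ.≤-pred y≤i))
          ...   | tri≈ _ p≡j _ = contradiction (trans (sym πy≡πu) πy≡πj) πu≢πj
            where
            πy≡πj : π y ≡ π j
            πy≡πj = trans (sym (trans πp≡πw πw≡πy)) (cong π (toℕ-injective p≡j))
            πy≡πu : π y ≡ π u
            πy≡πu = interleaved⇒≡ (ℕ.≤-<-trans (ℕ.≤-pred y≤i) i<u , u<j , inj₂ j<v) πy≡πj (sym πv≡πu)
          ...   | tri> _ _ j<p = s≤s (ℕ.≤-trans (ℕ.≤-pred y≤i) (ℕ.<⇒≤ i<j)) , p , trans πp≡πw πw≡πy , j<p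

        straddle⇒openCount-after-i<after-j : Straddle → openCount (suc (toℕ i)) ℕ.< openCount (suc (toℕ j))
        straddle⇒openCount-after-i<after-j (u , v , i<u , u<j , πu≢πj , πv≡πu , inj₂ j<v) =
          openCount-after-i<after-j i<u u<j πu≢πj j<v πv≡πu
        straddle⇒openCount-after-i<after-j (u , v , i<u , u<j , πu≢πj , πv≡πu , inj₁ v<i) with classMax u
        ... | p , πp≡πu , pmax , u≤p with ℕ.<-cmp (toℕ p) (toℕ j)
        ...   | tri< p<j _ _ = ⊥-elim (no-class-max-between-reaching-below pmax (ℕ.<-≤-trans i<u u≤p) p<j
                                        (trans πv≡πu (sym πp≡πu)) (ℕ.<⇒≤ v<i))
        ...   | tri≈ _ p≡j _ = contradiction (trans (sym πp≡πu) (cong π (toℕ-injective p≡j))) πu≢πj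
        ...   | tri> _ _ j<p = openCount-after-i<after-j i<u u<j πu≢πj j<p πp≡πu

      ⪯ᵒ⇒¬straddle : suc (toℕ i) ⪯ᵒ suc (toℕ j) → ¬ Straddle
      ⪯ᵒ⇒¬straddle (after-j≤after-i , above) straddle =
        ℕ.<⇒≱ (straddle⇒openCount-after-i<after-j above straddle) after-j≤after-i

      ¬straddle⇔⪯ᵒ : (¬ Straddle) ⇔ (suc (toℕ i) ⪯ᵒ suc (toℕ j))
      ¬straddle⇔⪯ᵒ = mk⇔ ¬straddle⇒⪯ᵒ ⪯ᵒ⇒¬straddle

lemma2p5 : ∀ {n} (π : Partition n) → NonCrossing π →
    (i j : Fin n) → IsMax π i → IsMax π j → i < j →
    NonCrossing (merge π i j) ⇔ (suc (toℕ i) ⪯[ θ π ] suc (toℕ j))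
lemma2p5 π nc i j imax jmax i<j =
  merge-nonCrossing⇔¬straddle π nc imax jmax i<j ⟨ ⇔-trans ⟩
  ¬straddle⇔⪯ᵒ π nc imax jmax i<j ⟨ ⇔-trans ⟩
  ⇔-sym (⪯⇔⪯ᵒ π (toℕ<n i) (toℕ<n j))
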